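{- There exists a bounded poset $P$ that is not graded, that is CL-shellable, and that is not EL-shellable.
   Context: A poset $P$ is bounded if it has a least element $\hat{0}$ and a greatest element $\hat{1}$; it is graded if all maximal chains have the same length. For $x\lessdot y$ (a cover relation) the pair $(x,y)$ is an edge of the Hasse diagram. An edge labeling of a bounded poset $P$ is a map $\lambda$ from the set of edges of the Hasse diagram of $P$ to a poset $\Lambda$. A saturated chain $x_0\lessdot x_1\lessdot\cdots\lessdot x_k$ is weakly increasing if $\lambda(x_0,x_1)\le\lambda(x_1,x_2)\le\cdots\le\lambda(x_{k-1},x_k)$ in $\Lambda$; maximal chains of an interval are compared lexicographically by their label sequences read upward. An EL-labeling of $P$ is an edge labeling such that every closed interval $[x,y]$ of $P$ has a unique weakly increasing maximal chain, and this chain lexicographically precedes all other maximal chains of $[x,y]$. $P$ is EL-shellable if it admits an EL-labeling. For $x\le y$ and a maximal chain $r$ of $[\hat{0},x]$, the pair $[x,y]_r$ is called a rooted interval. A chain-edge labeling of $P$ is a map $\lambda$ from the set of pairs $(c,e)$, where $c$ is a maximal chain of $P$ and $e$ is an edge (cover relation) in $c$, to a poset $\Lambda$, such that $\lambda(c,e)=\lambda(c',e)$ whenever $c$ and $c'$ coincide from $\hat{0}$ up to $e$. Thus every maximal chain of a rooted interval $[x,y]_r$ receives a well-defined sequence of labels (computed with any maximal chain of $P$ extending $r$ and that chain). A CL-labeling of $P$ is a chain-edge labeling such that in every rooted interval $[x,y]_r$ there is a unique strictly increasing maximal chain, and it lexicographically precedes all other maximal chains of $[x,y]_r$. $P$ is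 CL-shellable if it admits a CL-labeling. -}

module Defs where

open import Level using (0ℓ)
open import Data.Nat using (ℕ; zero; suc)
open import Data.List using (List; []; _∷_; _++_; [_])
open import Data.List.Membership.Propositional using (_∈_)
open import Data.Product using (Σ; _×_; _,_; ∃-syntax)
open import Data.Sum using (_⊎_)
open import Data.Empty using (⊥)
open import Data.Unit using (⊤)
open import Relation.Nullary using (¬_)
open import Relation.Binary.PropositionalEquality using (_≡_; _≢_)
open import Relation.Binary.Structures using (IsPartialOrder)
open import Relation.Binary.Bundles using (Poset)

record FinBoundedPoset : Set₁ where
  field
    Carrier        : Set
    _≤_            : Carrier → Carrier → Set
    isPartialOrder : IsPartialOrder _≡_ _≤_
    elements       : List Carrier
    complete       : ∀ x → x ∈ elements
    𝟘 𝟙            : Carrier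
    𝟘-least        : ∀ x → 𝟘 ≤ x
    𝟙-greatest     : ∀ x → x ≤ 𝟙

  _<_ : Carrier → Carrier → Set
  x < y = x ≤ y × x ≢ y

  _⋖_ : Carrier → Carrier → Set
  x ⋖ y = x < y × (∀ z → x < z → z < y → ⊥)

  -- saturated chains  x = x₀ ⋖ x₁ ⋖ ⋯ ⋖ xₖ = y ; these are exactly the
  -- maximal chains of the closed interval [x , y] (P finite).
  data Chain : Carrier → Carrier → Set where
    done : ∀ x → Chain x x
    step : ∀ {x y z} → x ⋖ y → Chain y z → Chain x z

  elems : ∀ {x y} → Chain x y → List Carrier
  elems (done x)           = x ∷ []
  elems (step {x = x} _ c) = x ∷ elems c

  length : ∀ {x y} → Chain x y → ℕ
  length (done _)   = zero
  length (step _ c) = suc (length c)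

open FinBoundedPoset public

Graded : FinBoundedPoset → Set
Graded P = ∀ (c c' : Chain P (𝟘 P) (𝟙 P)) → length P c ≡ length P c'

module LabelOrder (Λ : Poset 0ℓ 0ℓ 0ℓ) where
  open Poset Λ renaming (Carrier to L; _≤_ to _≤L_; _≈_ to _≈L_)

  _<L_ : L → L → Set
  a <L b = a ≤L b × ¬ (a ≈L b)

  WeaklyIncr : List L → Set
  WeaklyIncr []            = ⊤
  WeaklyIncr (a ∷ [])      = ⊤
  WeaklyIncr (a ∷ b ∷ as)  = a ≤L b × WeaklyIncr (b ∷ as)

  StrictIncr : List L → Set
  StrictIncr []            = ⊤
  StrictIncr (a ∷ [])      = ⊤
  StrictIncr (a ∷ b ∷ as)  = a <L b × StrictIncr (b ∷ as)

  data LexLT : List L → List L → Set where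
    here   : ∀ {a b as bs} → a <L b → LexLT (a ∷ as) (b ∷ bs)
    there  : ∀ {a b as bs} → a ≈L b → LexLT as bs → LexLT (a ∷ as) (b ∷ bs)
    prefix : ∀ {b bs} → LexLT [] (b ∷ bs)

module _ (P : FinBoundedPoset) (Λ : Poset 0ℓ 0ℓ 0ℓ) where
  open FinBoundedPoset P using () renaming (Carrier to X; _≤_ to _≤P_)
  open Poset Λ renaming (Carrier to L)
  open LabelOrder Λ

  -- Edge labeling: a label for every edge (x , y) of the Hasse diagram
  -- (given as a function on all pairs; only its values on covers are used).
  EdgeLabeling : Set
  EdgeLabeling = X → X → L

  edgeLabels : EdgeLabeling → ∀ {x y} → Chain P x y → List L
  edgeLabels λ' (done _)                   = []
  edgeLabels λ' (step {x = x} {y = y} _ c) = λ' x y ∷ edgeLabels λ' c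

  IsEL : EdgeLabeling → Set
  IsEL λ' = ∀ x y → x ≤P y →
    Σ (Chain P x y) λ c →
        WeaklyIncr (edgeLabels λ' c)
      × (∀ (c' : Chain P x y) → WeaklyIncr (edgeLabels λ' c') → elems P c' ≡ elems P c)
      × (∀ (c' : Chain P x y) → elems P c' ≢ elems P c →
           LexLT (edgeLabels λ' c) (edgeLabels λ' c'))

  -- Chain-edge labeling: the label of an edge (x , y) in a maximal chain c
  -- depends only on the part of c from 0̂ up to x (given as its list of
  -- elements 0̂ , … , x) and on y; this builds in the required compatibility.
  ChainEdgeLabeling : Set
  ChainEdgeLabeling = List X → X → L

  chainLabels : ChainEdgeLabeling → List X → ∀ {x y} → Chain P x y → List L
  chainLabels λ' root (done _)             = []
  chainLabels λ' root (step {y = y} _ c)   = λ' root y ∷ chainLabels λ' (root ++ [ y ]) c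

  IsCL : ChainEdgeLabeling → Set
  IsCL λ' = ∀ x y → x ≤P y → (r : Chain P (𝟘 P) x) →
    Σ (Chain P x y) λ c →
        StrictIncr (chainLabels λ' (elems P r) c)
      × (∀ (c' : Chain P x y) → StrictIncr (chainLabels λ' (elems P r) c') → elems P c' ≡ elems P c)
      × (∀ (c' : Chain P x y) → elems P c' ≢ elems P c →
           LexLT (chainLabels λ' (elems P r) c) (chainLabels λ' (elems P r) c'))

ELShellable : FinBoundedPoset → Set₁
ELShellable P = Σ (Poset 0ℓ 0ℓ 0ℓ) λ Λ → Σ (EdgeLabeling P Λ) λ λ' → IsEL P Λ λ'

CLShellable : FinBoundedPoset → Set₁
CLShellable P = Σ (Poset 0ℓ 0ℓ 0ℓ) λ Λ → Σ (ChainEdgeLabeling P Λ) λ λ' → IsCL P Λ λ'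

-- The witness is a twelve-element poset (module Example) whose maximal
-- chains have lengths 4, 5 and 6.
--   * Not EL-shellable: in an EL-labeling the only chain of an interval is
--     weakly increasing and no interval has two weakly increasing chains.
--     Seven intervals with a single chain plus the two-chain interval [7,11]
--     force two weakly increasing chains in [3,11] or in [1,11].
--   * CL-shellable: an explicit labeling of the maximal chains by natural
--     numbers; the CL conditions in every rooted interval are verified by
--     enumerating its saturated chains.
module Submission where

open import Defs
open import Level using (0ℓ)
open import Data.Bool using (Bool; T; if_then_else_)
open import Data.Maybe using (Maybe; just; nothing; fromMaybe; _<∣>_)
open import Data.Bool.ListAction using (any)
open import Data.Empty using (⊥; ⊥-elim)
open import Data.Fin as Fin using (Fin; toℕ; #_)
open import Data.Vec using (Vec; lookup) renaming ([] to []ᵥ; _∷_ to _∷ᵥ_)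
import Data.Fin.Properties as Finₚ
open import Data.List as List using (List; []; _∷_; _++_; [_])
import Data.List.Properties as Listₚ
open import Data.List.Membership.Propositional using (_∈_; mapWith∈)
open import Data.List.Membership.Propositional.Properties using (∈-allFin)
open import Data.List.Relation.Unary.All as All using (All)
open import Data.List.Relation.Unary.Any as Any using (Any; here; there)
import Data.List.Relation.Unary.Any.Properties as Anyₚ
open import Data.Nat as ℕ using (ℕ; zero; suc; _+_; s≤s)
import Data.Nat.Properties as ℕₚ
open import Data.Product using (Σ; _×_; _,_; proj₁; proj₂; curry; uncurry)
open import Data.Sum using (_⊎_; inj₁; inj₂)
open import Data.Unit using (tt)
open import Relation.Binary.Bundles using (Poset)
open import Relation.Binary.Structures using (IsPartialOrder)
import Relation.Binary.PropositionalEquality as Eq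
open Eq using (_≡_; _≢_; refl; sym; trans; cong; subst; subst₂; module ≡-Reasoning)
open import Relation.Nullary using (¬_; Dec; yes; no; ¬?)
open import Relation.Nullary.Decidable using (⌊_⌋; True; toWitness; map′; _×-dec_; _⊎-dec_; _→-dec_; T?)

module _ {P : FinBoundedPoset} where
  open FinBoundedPoset P using () renaming (Carrier to X; _≤_ to _≤ₚ_; isPartialOrder to ≤-isPartialOrder)

  elems-head : ∀ {x y} (c : Chain P x y) → Σ (List X) λ t → elems P c ≡ x ∷ t
  elems-head (done x)   = [] , refl
  elems-head (step _ c) = elems P c , refl

  chain⇒≤ : ∀ {x y} → Chain P x y → x ≤ₚ y
  chain⇒≤ (done x)   = IsPartialOrder.refl ≤-isPartialOrder
  chain⇒≤ (step x⋖y c) = IsPartialOrder.trans ≤-isPartialOrder (proj₁ (proj₁ x⋖y)) (chain⇒≤ c)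

module _ (P : FinBoundedPoset) (Λ : Poset 0ℓ 0ℓ 0ℓ) where
  open FinBoundedPoset P using () renaming (Carrier to X)
  open Poset Λ using () renaming (Carrier to L)

  labelsAlong : EdgeLabeling P Λ → List X → List L
  labelsAlong λ' (a ∷ b ∷ l) = λ' a b ∷ labelsAlong λ' (b ∷ l)
  labelsAlong λ' _           = []

  edgeLabels≡labelsAlong : (λ' : EdgeLabeling P Λ) {x y : X} (c : Chain P x y) →
                           edgeLabels P Λ λ' c ≡ labelsAlong λ' (elems P c)
  edgeLabels≡labelsAlong λ' (done _) = refl
  edgeLabels≡labelsAlong λ' (step {x = x} {y = y} _ c)
    with elems P c | elems-head c | edgeLabels≡labelsAlong λ' c
  ... | .(y ∷ t) | t , refl | labels-c = cong (λ' x y ∷_) labels-c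

  -- Label sequence of a chain-edge labeling along a list of elements,
  -- rooted at the chain R from 0̂ to its first element.
  rootedLabels : ChainEdgeLabeling P Λ → List X → List X → List L
  rootedLabels λ' R (a ∷ b ∷ l) = λ' R b ∷ rootedLabels λ' (R ++ [ b ]) (b ∷ l)
  rootedLabels λ' R _           = []

  chainLabels≡rootedLabels : (λ' : ChainEdgeLabeling P Λ) (R : List X) {x y : X} (c : Chain P x y) →
                             chainLabels P Λ λ' R c ≡ rootedLabels λ' R (elems P c)
  chainLabels≡rootedLabels λ' R (done _) = refl
  chainLabels≡rootedLabels λ' R (step {y = y} _ c)
    with elems P c | elems-head c | chainLabels≡rootedLabels λ' (R ++ [ y ]) c
  ... | .(y ∷ t) | t , refl | labels-c = cong (λ' R y ∷_) labels-c

module ELConsequences {P : FinBoundedPoset} {Λ : Poset 0ℓ 0ℓ 0ℓ}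
                      (λ' : EdgeLabeling P Λ) (isEL : IsEL P Λ λ') where
  open FinBoundedPoset P using () renaming (Carrier to X; _≤_ to _≤ₚ_)
  open LabelOrder Λ using (WeaklyIncr)

  Increasing : ∀ {x y} → Chain P x y → Set
  Increasing c = WeaklyIncr (edgeLabels P Λ λ' c)

  increasing-cong : ∀ {x y} {c c' : Chain P x y} → elems P c ≡ elems P c' → Increasing c → Increasing c'
  increasing-cong {c = c} {c'} same = subst WeaklyIncr (begin
      edgeLabels P Λ λ' c             ≡⟨ edgeLabels≡labelsAlong P Λ λ' c ⟩
      labelsAlong P Λ λ' (elems P c)  ≡⟨ cong (labelsAlong P Λ λ') same ⟩
      labelsAlong P Λ λ' (elems P c') ≡⟨ sym (edgeLabels≡labelsAlong P Λ λ' c') ⟩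
      edgeLabels P Λ λ' c'            ∎)
    where open ≡-Reasoning

  increasing-unique : ∀ {x y} (c c' : Chain P x y) → Increasing c → Increasing c' → elems P c ≡ elems P c'
  increasing-unique c c' inc inc' with isEL _ _ (chain⇒≤ c)
  ... | _ , _ , unique , _ = trans (unique c inc) (sym (unique c' inc'))

  some-listed-increasing : ∀ {x y} (cs : List (Chain P x y)) → x ≤ₚ y →
                           (∀ c → Any (λ c₀ → elems P c ≡ elems P c₀) cs) → Any Increasing cs
  some-listed-increasing cs x≤y exhaustive with isEL _ _ x≤y
  ... | w , w-increasing , _ = Any.map (λ same → increasing-cong same w-increasing) (exhaustive w)

  only-chain-increasing : ∀ {x y} (c : Chain P x y) →
                          (∀ c' → Any (λ c₀ → elems P c' ≡ elems P c₀) [ c ]) → Increasing c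
  only-chain-increasing c only = Anyₚ.singleton⁻ (some-listed-increasing [ c ] (chain⇒≤ c) only)

module ℕLabels where
  open LabelOrder ℕₚ.≤-poset public using (StrictIncr; LexLT; here; there; prefix)

  strictIncr? : (ls : List ℕ) → Dec (StrictIncr ls)
  strictIncr? []           = yes tt
  strictIncr? (a ∷ [])     = yes tt
  strictIncr? (a ∷ b ∷ ls) = ((a ℕ.≤? b) ×-dec ¬? (a ℕ.≟ b)) ×-dec strictIncr? (b ∷ ls)

  lexLT? : (as bs : List ℕ) → Dec (LexLT as bs)
  lexLT? []       []       = no λ ()
  lexLT? []       (b ∷ bs) = yes prefix
  lexLT? (a ∷ as) []       = no λ ()
  lexLT? (a ∷ as) (b ∷ bs) with (a ℕ.≤? b) ×-dec ¬? (a ℕ.≟ b) | a ℕ.≟ b | lexLT? as bs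
  ... | yes a<b | _        | _        = yes (here a<b)
  ... | no  a≮b | yes refl | yes tail = yes (there refl tail)
  ... | no  a≮b | yes refl | no ¬tail = no λ { (here a<b) → a≮b a<b ; (there _ tail) → ¬tail tail }
  ... | no  a≮b | no  a≢b  | _        = no λ { (here a<b) → a≮b a<b ; (there a≡b _) → a≢b a≡b }

-- A bounded poset on Fin n given by a decidable order whose numbering of
-- the elements is a linear extension.  Its saturated chains can then be
-- enumerated, which turns statements about all chains into computations.
module FinitePoset
  (n : ℕ) (_≤ᵇ_ : Fin n → Fin n → Bool) (bottom top : Fin n)
  (≤-refl    : ∀ x → T (x ≤ᵇ x))
  (≤-trans   : ∀ x y z → T (x ≤ᵇ y) → T (y ≤ᵇ z) → T (x ≤ᵇ z))
  (≤-antisym : ∀ x y → T (x ≤ᵇ y) → T (y ≤ᵇ x) → x ≡ y)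
  (bottom-least : ∀ x → T (bottom ≤ᵇ x))
  (top-greatest : ∀ x → T (x ≤ᵇ top))
  (numbering-monotone : ∀ x y → T (x ≤ᵇ y) → x ≢ y → toℕ x ℕ.< toℕ y)
  where

  P : FinBoundedPoset
  P = record
    { Carrier        = Fin n
    ; _≤_            = λ x y → T (x ≤ᵇ y)
    ; isPartialOrder = record
        { isPreorder = record
            { isEquivalence = Eq.isEquivalence
            ; reflexive     = λ { {x} refl → ≤-refl x }
            ; trans         = λ {x} {y} {z} → ≤-trans x y z }
        ; antisym = λ {x} {y} → ≤-antisym x y }
    ; elements     = List.allFin n
    ; complete     = ∈-allFin
    ; 𝟘            = bottom
    ; 𝟙            = top
    ; 𝟘-least      = bottom-least
    ; 𝟙-greatest   = top-greatest }

  open FinBoundedPoset P public using () renaming (_<_ to _<ₚ_; _⋖_ to _⋖ₚ_)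

  _<?_ : ∀ x y → Dec (x <ₚ y)
  x <? y = T? (x ≤ᵇ y) ×-dec ¬? (x Fin.≟ y)

  _⋖?_ : ∀ x y → Dec (x ⋖ₚ y)
  x ⋖? y = (x <? y) ×-dec map′ (λ nothing-between z → curry (nothing-between z))
                                (λ nothing-between z → uncurry (nothing-between z))
                                (Finₚ.all? λ z → ¬? ((x <? z) ×-dec (z <? y)))

  -- Covers certified by computation, for writing down concrete chains.
  infixr 6 _▸_
  _▸_ : ∀ x {y z} {x⋖y : True (x ⋖? y)} → Chain P y z → Chain P x z
  _▸_ x {x⋖y = x⋖y} c = step (toWitness x⋖y) c

  chain-numbering : ∀ {x y} (c : Chain P x y) → length P c + toℕ x ℕ.≤ toℕ y
  chain-numbering (done x) = ℕₚ.≤-refl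
  chain-numbering {x} (step {y = z} ((x≤z , x≢z) , _) c) = begin
    suc (length P c + toℕ x) ≡⟨ sym (ℕₚ.+-suc (length P c) (toℕ x)) ⟩
    length P c + suc (toℕ x) ≤⟨ ℕₚ.+-monoʳ-≤ (length P c) (numbering-monotone x z x≤z x≢z) ⟩
    length P c + toℕ z       ≤⟨ chain-numbering c ⟩
    _                        ∎
    where open ℕₚ.≤-Reasoning

  -- Hence n bounds the length of every chain; it serves as search depth.
  chain-length≤n : ∀ {x y} (c : Chain P x y) → length P c ℕ.≤ n
  chain-length≤n {x} {y} c = ℕₚ.≤-trans (ℕₚ.m≤m+n (length P c) (toℕ x))
                                       (ℕₚ.≤-trans (chain-numbering c) (ℕₚ.<⇒≤ (Finₚ.toℕ<n y)))

  no-nontrivial-loop : ∀ {x z} → x ⋖ₚ z → Chain P z x → ⊥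
  no-nontrivial-loop {x} {z} ((x≤z , x≢z) , _) c =
    ℕₚ.<⇒≱ (numbering-monotone x z x≤z x≢z) (ℕₚ.≤-trans (ℕₚ.m≤n+m (toℕ z) (length P c)) (chain-numbering c))

  module Enumeration (upperCovers : Fin n → List (Fin n))
                     (listed-are-covers : ∀ x → All (x ⋖ₚ_) (upperCovers x))
                     (covers-are-listed : ∀ x z → x ⋖ₚ z → z ∈ upperCovers x) where

    chainsWithin : ℕ → (x y : Fin n) → List (Chain P x y)
    chainsWithin k x y with x Fin.≟ y
    chainsWithin k       x .x | yes refl = [ done x ]
    chainsWithin zero    x y  | no _     = []
    chainsWithin (suc k) x y  | no _     = List.concat (mapWith∈ (upperCovers x) λ z∈ →
      List.map (step (All.lookup (listed-are-covers x) z∈)) (chainsWithin k _ y))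

    chainsWithin-complete : ∀ k {x y} (c : Chain P x y) → length P c ℕ.≤ k →
                            Any (λ c₀ → elems P c ≡ elems P c₀) (chainsWithin k x y)
    chainsWithin-complete k {x} (done x) _ with x Fin.≟ x
    ... | yes refl = here refl
    ... | no x≢x   = ⊥-elim (x≢x refl)
    chainsWithin-complete k {x} {y} (step {y = z} x⋖z c) _ with x Fin.≟ y
    chainsWithin-complete k (step x⋖z c) _ | yes refl = ⊥-elim (no-nontrivial-loop x⋖z c)
    chainsWithin-complete (suc k) {x} {y} (step {y = z} x⋖z c) (s≤s |c|≤k) | no _ =
      Anyₚ.concat⁺ (Anyₚ.mapWith∈⁺ _ (z , covers-are-listed x z x⋖z ,
        Anyₚ.map⁺ (Any.map (cong (x ∷_)) (chainsWithin-complete k c |c|≤k))))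

    chains : (x y : Fin n) → List (Chain P x y)
    chains = chainsWithin n

    every-chain : ∀ {x y} {Q : List (Fin n) → Set} →
                  All (λ c₀ → Q (elems P c₀)) (chains x y) → (c : Chain P x y) → Q (elems P c)
    every-chain {Q = Q} verified c
      with All.lookupAny verified (chainsWithin-complete n c (chain-length≤n c))
    ... | holds , same = subst Q (sym same) holds

    exhaustive : ∀ {x y} (cs : List (Chain P x y)) →
                 {_ : True (All.all? (λ c₀ → Any.any? (λ c₁ → Listₚ.≡-dec Fin._≟_ (elems P c₀) (elems P c₁)) cs) (chains x y))} →
                 ∀ c → Any (λ c₀ → elems P c ≡ elems P c₀) cs
    exhaustive cs {verified} = every-chain {Q = λ l → Any (λ c₀ → l ≡ elems P c₀) cs} (toWitness verified)

    module CLCertificate (λ' : ChainEdgeLabeling P ℕₚ.≤-poset) where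
      open ℕLabels

      labels : List (Fin n) → List (Fin n) → List ℕ
      labels = rootedLabels P ℕₚ.≤-poset λ'

      Loses : List (Fin n) → List (Fin n) → List (Fin n) → Set
      Loses R lw l = ¬ StrictIncr (labels R l) × LexLT (labels R lw) (labels R l)

      Winner : List (Fin n) → ∀ {x y} → Chain P x y → Set
      Winner R {x} {y} w = StrictIncr (labels R (elems P w))
                         × All (λ c → elems P c ≡ elems P w ⊎ Loses R (elems P w) (elems P c)) (chains x y)

      winner? : ∀ R {x y} (w : Chain P x y) → Dec (Winner R w)
      winner? R {x} {y} w = strictIncr? (labels R (elems P w)) ×-dec All.all? verdict? (chains x y)
        where
        verdict? : ∀ c → Dec (elems P c ≡ elems P w ⊎ Loses R (elems P w) (elems P c))
        verdict? c = Listₚ.≡-dec Fin._≟_ (elems P c) (elems P w)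
                     ⊎-dec (¬? (strictIncr? (labels R (elems P c)))
                            ×-dec lexLT? (labels R (elems P w)) (labels R (elems P c)))

      Certificate : Set
      Certificate = ∀ x y → T (x ≤ᵇ y) → All (λ r → Any (Winner (elems P r)) (chains x y)) (chains bottom x)

      certificate? : Dec Certificate
      certificate? = Finₚ.all? λ x → Finₚ.all? λ y →
        T? (x ≤ᵇ y) →-dec All.all? (λ r → Any.any? (winner? (elems P r)) (chains x y)) (chains bottom x)

      certificate⇒CL : Certificate → IsCL P ℕₚ.≤-poset λ'
      certificate⇒CL certificate x y x≤y r = w , increasing , unique , first
        where
        R = elems P r
        winner : Σ (Chain P x y) (Winner R)
        winner = Any.satisfied (every-chain {Q = λ R → Any (Winner R) (chains x y)} (certificate x y x≤y) r)
        w = proj₁ winner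
        labels-of : (c : Chain P x y) → chainLabels P ℕₚ.≤-poset λ' R c ≡ labels R (elems P c)
        labels-of = chainLabels≡rootedLabels P ℕₚ.≤-poset λ' R
        verdict : ∀ c → elems P c ≡ elems P w ⊎ Loses R (elems P w) (elems P c)
        verdict = every-chain {Q = λ l → l ≡ elems P w ⊎ Loses R (elems P w) l} (proj₂ (proj₂ winner))

        increasing : StrictIncr (chainLabels P ℕₚ.≤-poset λ' R w)
        increasing = subst StrictIncr (sym (labels-of w)) (proj₁ (proj₂ winner))
        unique : ∀ c → StrictIncr (chainLabels P ℕₚ.≤-poset λ' R c) → elems P c ≡ elems P w
        unique c c-increasing with verdict c
        ... | inj₁ same                 = same
        ... | inj₂ (not-increasing , _) = ⊥-elim (not-increasing (subst StrictIncr (labels-of c) c-increasing))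
        first : ∀ c → elems P c ≢ elems P w → LexLT (chainLabels P ℕₚ.≤-poset λ' R w) (chainLabels P ℕₚ.≤-poset λ' R c)
        first c different with verdict c
        ... | inj₁ same           = ⊥-elim (different same)
        ... | inj₂ (_ , w-before) = subst₂ LexLT (sym (labels-of w)) (sym (labels-of c)) w-before

-- The example: elements 0 , … , 11, numbered along a linear extension, with
-- Hasse diagram
--   0 ⋖ 1 , 2     1 ⋖ 4 , 7     2 ⋖ 3 , 4     3 ⋖ 5 , 7     4 ⋖ 6 , 8
--   5 ⋖ 6 , 9     6 ⋖ 10        7 ⋖ 8 , 9     8 , 9 , 10 ⋖ 11
-- Its maximal chains have lengths 4, 5 and 6.
module Example where
  open import Data.List.Membership.DecPropositional (Fin._≟_ {12}) using (_∈?_)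

  upperCovers : Vec (List (Fin 12)) 12
  upperCovers = (# 1 ∷ # 2 ∷ []) ∷ᵥ (# 4 ∷ # 7 ∷ []) ∷ᵥ (# 3 ∷ # 4 ∷ []) ∷ᵥ (# 5 ∷ # 7 ∷ []) ∷ᵥ
                (# 6 ∷ # 8 ∷ []) ∷ᵥ (# 6 ∷ # 9 ∷ []) ∷ᵥ (# 10 ∷ []) ∷ᵥ (# 8 ∷ # 9 ∷ []) ∷ᵥ
                (# 11 ∷ []) ∷ᵥ (# 11 ∷ []) ∷ᵥ (# 11 ∷ []) ∷ᵥ [] ∷ᵥ []ᵥ

  upSets : Vec (List ℕ) 12
  upSets = (0 ∷ 1 ∷ 2 ∷ 3 ∷ 4 ∷ 5 ∷ 6 ∷ 7 ∷ 8 ∷ 9 ∷ 10 ∷ 11 ∷ []) ∷ᵥ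
           (1 ∷ 4 ∷ 6 ∷ 7 ∷ 8 ∷ 9 ∷ 10 ∷ 11 ∷ []) ∷ᵥ
           (2 ∷ 3 ∷ 4 ∷ 5 ∷ 6 ∷ 7 ∷ 8 ∷ 9 ∷ 10 ∷ 11 ∷ []) ∷ᵥ
           (3 ∷ 5 ∷ 6 ∷ 7 ∷ 8 ∷ 9 ∷ 10 ∷ 11 ∷ []) ∷ᵥ
           (4 ∷ 6 ∷ 8 ∷ 10 ∷ 11 ∷ []) ∷ᵥ
           (5 ∷ 6 ∷ 9 ∷ 10 ∷ 11 ∷ []) ∷ᵥ
           (6 ∷ 10 ∷ 11 ∷ []) ∷ᵥ
           (7 ∷ 8 ∷ 9 ∷ 11 ∷ []) ∷ᵥ
           (8 ∷ 11 ∷ []) ∷ᵥ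
           (9 ∷ 11 ∷ []) ∷ᵥ
           (10 ∷ 11 ∷ []) ∷ᵥ
           (11 ∷ []) ∷ᵥ []ᵥ

  infix 4 _≤ᵇ_
  _≤ᵇ_ : Fin 12 → Fin 12 → Bool
  x ≤ᵇ y = any (toℕ y ℕ.≡ᵇ_) (lookup upSets x)

  ≤ᵇ-refl : ∀ x → T (x ≤ᵇ x)
  ≤ᵇ-refl = toWitness {a? = Finₚ.all? λ x → T? (x ≤ᵇ x)} tt

  ≤ᵇ-trans : ∀ x y z → T (x ≤ᵇ y) → T (y ≤ᵇ z) → T (x ≤ᵇ z)
  ≤ᵇ-trans = toWitness {a? = Finₚ.all? λ x → Finₚ.all? λ y → Finₚ.all? λ z →
                              T? (x ≤ᵇ y) →-dec T? (y ≤ᵇ z) →-dec T? (x ≤ᵇ z)} tt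

  ≤ᵇ-antisym : ∀ x y → T (x ≤ᵇ y) → T (y ≤ᵇ x) → x ≡ y
  ≤ᵇ-antisym = toWitness {a? = Finₚ.all? λ x → Finₚ.all? λ y →
                                T? (x ≤ᵇ y) →-dec T? (y ≤ᵇ x) →-dec x Fin.≟ y} tt

  0-least : ∀ x → T (# 0 ≤ᵇ x)
  0-least = toWitness {a? = Finₚ.all? λ x → T? (# 0 ≤ᵇ x)} tt

  11-greatest : ∀ x → T (x ≤ᵇ # 11)
  11-greatest = toWitness {a? = Finₚ.all? λ x → T? (x ≤ᵇ # 11)} tt

  numbering-monotone : ∀ x y → T (x ≤ᵇ y) → x ≢ y → toℕ x ℕ.< toℕ y
  numbering-monotone = toWitness {a? = Finₚ.all? λ x → Finₚ.all? λ y →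
                                        T? (x ≤ᵇ y) →-dec ¬? (x Fin.≟ y) →-dec toℕ x ℕ.<? toℕ y} tt

  open FinitePoset 12 _≤ᵇ_ (# 0) (# 11) ≤ᵇ-refl ≤ᵇ-trans ≤ᵇ-antisym 0-least 11-greatest numbering-monotone public

  listed-are-covers : ∀ x → All (x ⋖ₚ_) (lookup upperCovers x)
  listed-are-covers = toWitness {a? = Finₚ.all? λ x → All.all? (x ⋖?_) (lookup upperCovers x)} tt

  covers-are-listed : ∀ x z → x ⋖ₚ z → z ∈ lookup upperCovers x
  covers-are-listed = toWitness {a? = Finₚ.all? λ x → Finₚ.all? λ z → (x ⋖? z) →-dec (z ∈? lookup upperCovers x)} tt

  open Enumeration (lookup upperCovers) listed-are-covers covers-are-listed public

  ⟨0-1-7-9-11⟩ ⟨0-1-4-6-10-11⟩ : Chain P (# 0) (# 11)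
  ⟨0-1-7-9-11⟩    = # 0 ▸ # 1 ▸ # 7 ▸ # 9 ▸ done (# 11)
  ⟨0-1-4-6-10-11⟩ = # 0 ▸ # 1 ▸ # 4 ▸ # 6 ▸ # 10 ▸ done (# 11)

  ⟨1-4-6-10-11⟩ ⟨1-7-9-11⟩ : Chain P (# 1) (# 11)
  ⟨1-4-6-10-11⟩ = # 1 ▸ # 4 ▸ # 6 ▸ # 10 ▸ done (# 11)
  ⟨1-7-9-11⟩    = # 1 ▸ # 7 ▸ # 9 ▸ done (# 11)

  ⟨3-5-6-10-11⟩ ⟨3-7-8-11⟩ : Chain P (# 3) (# 11)
  ⟨3-5-6-10-11⟩ = # 3 ▸ # 5 ▸ # 6 ▸ # 10 ▸ done (# 11)
  ⟨3-7-8-11⟩    = # 3 ▸ # 7 ▸ # 8 ▸ done (# 11)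

  ⟨7-8-11⟩ ⟨7-9-11⟩ : Chain P (# 7) (# 11)
  ⟨7-8-11⟩ = # 7 ▸ # 8 ▸ done (# 11)
  ⟨7-9-11⟩ = # 7 ▸ # 9 ▸ done (# 11)

  not-graded : ¬ Graded P
  not-graded graded with graded ⟨0-1-7-9-11⟩ ⟨0-1-4-6-10-11⟩
  ... | ()

  -- The intervals [3,6], [5,10], [6,11], [3,8], [1,6],
  -- [4,10], [1,9] have a single maximal chain, which must therefore increase;
  -- the interval [7,11] has the two chains 7-8-11 and 7-9-11, one of which
  -- increases.  If 7-8-11 increases, then 3-5-6-10-11 and 3-7-8-11 both
  -- increase in [3,11]; if 7-9-11 increases, then 1-4-6-10-11 and 1-7-9-11
  -- both increase in [1,11].  Either way an interval has two increasing chains.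
  module NoELLabeling {Λ : Poset 0ℓ 0ℓ 0ℓ} (λ' : EdgeLabeling P Λ) (isEL : IsEL P Λ λ') where
    open ELConsequences λ' isEL
    open Poset Λ using () renaming (_≤_ to _≤L_)

    -- rises forced by intervals with a single chain
    3-5-6↑ : λ' (# 3) (# 5) ≤L λ' (# 5) (# 6)
    3-5-6↑ = proj₁ (only-chain-increasing (# 3 ▸ # 5 ▸ done (# 6)) (exhaustive _))

    5-6-10↑ : λ' (# 5) (# 6) ≤L λ' (# 6) (# 10)
    5-6-10↑ = proj₁ (only-chain-increasing (# 5 ▸ # 6 ▸ done (# 10)) (exhaustive _))

    6-10-11↑ : λ' (# 6) (# 10) ≤L λ' (# 10) (# 11)
    6-10-11↑ = proj₁ (only-chain-increasing (# 6 ▸ # 10 ▸ done (# 11)) (exhaustive _))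

    3-7-8↑ : λ' (# 3) (# 7) ≤L λ' (# 7) (# 8)
    3-7-8↑ = proj₁ (only-chain-increasing (# 3 ▸ # 7 ▸ done (# 8)) (exhaustive _))

    1-4-6↑ : λ' (# 1) (# 4) ≤L λ' (# 4) (# 6)
    1-4-6↑ = proj₁ (only-chain-increasing (# 1 ▸ # 4 ▸ done (# 6)) (exhaustive _))

    4-6-10↑ : λ' (# 4) (# 6) ≤L λ' (# 6) (# 10)
    4-6-10↑ = proj₁ (only-chain-increasing (# 4 ▸ # 6 ▸ done (# 10)) (exhaustive _))

    1-7-9↑ : λ' (# 1) (# 7) ≤L λ' (# 7) (# 9)
    1-7-9↑ = proj₁ (only-chain-increasing (# 1 ▸ # 7 ▸ done (# 9)) (exhaustive _))

    -- each increasing chain of [7,11] yields a second increasing chain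
    neither-7-11-chain-increases : Any Increasing (⟨7-8-11⟩ ∷ ⟨7-9-11⟩ ∷ []) → ⊥
    neither-7-11-chain-increases (here (7-8-11↑ , _)) =
      different (increasing-unique ⟨3-5-6-10-11⟩ ⟨3-7-8-11⟩ (3-5-6↑ , 5-6-10↑ , 6-10-11↑ , tt) (3-7-8↑ , 7-8-11↑ , tt))
      where different : elems P ⟨3-5-6-10-11⟩ ≢ elems P ⟨3-7-8-11⟩
            different ()
    neither-7-11-chain-increases (there (here (7-9-11↑ , _))) =
      different (increasing-unique ⟨1-4-6-10-11⟩ ⟨1-7-9-11⟩ (1-4-6↑ , 4-6-10↑ , 6-10-11↑ , tt) (1-7-9↑ , 7-9-11↑ , tt))
      where different : elems P ⟨1-4-6-10-11⟩ ≢ elems P ⟨1-7-9-11⟩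
            different ()

    contradiction : ⊥
    contradiction = neither-7-11-chain-increases
      (some-listed-increasing (⟨7-8-11⟩ ∷ ⟨7-9-11⟩ ∷ []) (chain⇒≤ ⟨7-8-11⟩) (exhaustive _))

  not-EL : ¬ ELShellable P
  not-EL (Λ , λ' , isEL) = NoELLabeling.contradiction λ' isEL

  -- The CL-labeling, given by the label sequences of the ten maximal chains;
  -- each step lists the element reached and the label of the edge into it.
  labelledChains : List (List (Fin 12 × ℕ))
  labelledChains =
    ((# 1 , 30) ∷ (# 4 , 13) ∷ (# 6 , 14) ∷ (# 10 , 15) ∷ (# 11 , 16) ∷ []) ∷
    ((# 1 , 30) ∷ (# 4 , 13) ∷ (# 8 , 17) ∷ (# 11 , 4) ∷ []) ∷
    ((# 1 , 30) ∷ (# 7 , 18) ∷ (# 8 , 7) ∷ (# 11 , 8) ∷ []) ∷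
    ((# 1 , 30) ∷ (# 7 , 18) ∷ (# 9 , 19) ∷ (# 11 , 3) ∷ []) ∷
    ((# 2 , 20) ∷ (# 3 , 21) ∷ (# 5 , 22) ∷ (# 6 , 25) ∷ (# 10 , 26) ∷ (# 11 , 27) ∷ []) ∷
    ((# 2 , 20) ∷ (# 3 , 21) ∷ (# 5 , 22) ∷ (# 9 , 28) ∷ (# 11 , 2) ∷ []) ∷
    ((# 2 , 20) ∷ (# 3 , 21) ∷ (# 7 , 23) ∷ (# 8 , 24) ∷ (# 11 , 1) ∷ []) ∷
    ((# 2 , 20) ∷ (# 3 , 21) ∷ (# 7 , 23) ∷ (# 9 , 5) ∷ (# 11 , 6) ∷ []) ∷
    ((# 2 , 20) ∷ (# 4 , 29) ∷ (# 6 , 9) ∷ (# 10 , 10) ∷ (# 11 , 11) ∷ []) ∷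
    ((# 2 , 20) ∷ (# 4 , 29) ∷ (# 8 , 12) ∷ (# 11 , 0) ∷ []) ∷ []

  -- The label of the last step of the path zs (from 0̂, with 0̂ omitted) if
  -- the labelled chain starts with zs.
  lastLabelAlong : List (Fin 12) → List (Fin 12 × ℕ) → Maybe ℕ
  lastLabelAlong (z ∷ [])      ((z' , l) ∷ _)     = if ⌊ z Fin.≟ z' ⌋ then just l else nothing
  lastLabelAlong (z ∷ z₂ ∷ zs) ((z' , _) ∷ steps) = if ⌊ z Fin.≟ z' ⌋ then lastLabelAlong (z₂ ∷ zs) steps else nothing
  lastLabelAlong _             _                  = nothing

  clLabel : ChainEdgeLabeling P ℕₚ.≤-poset
  clLabel root y = fromMaybe 0 (List.foldr (λ chain found → lastLabelAlong path chain <∣> found) nothing labelledChains)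
    where path = List.drop 1 root ++ [ y ]

  open CLCertificate clLabel using (certificate?; certificate⇒CL)

  is-CL : IsCL P ℕₚ.≤-poset clLabel
  is-CL = certificate⇒CL (toWitness {a? = certificate?} tt)

mainTheorem1 : Σ FinBoundedPoset λ P → ¬ Graded P × CLShellable P × ¬ ELShellable P
mainTheorem1 = P , not-graded , (ℕₚ.≤-poset , clLabel , is-CL) , not-EL
  where open Example
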